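{- For all integers $n\ge1$ and $k\ge1$, the residue of $\mathfrak B_{2n}^{(-k)}$ modulo $7$ depends only on $n\bmod 6$ and $k\bmod 6$, and is given, listing the values for $k\equiv 0,1,2,3,4,5\pmod 6$ in that order, by: $n\equiv 0\pmod 6$: $6,6,0,1,1,0$; $n\equiv 1\pmod 6$: $2,6,4,5,1,3$; $n\equiv 2\pmod 6$: $1,2,1,6,5,6$; $n\equiv 3\pmod 6$: $1,1,0,6,6,0$; $n\equiv 4\pmod 6$: $5,1,3,2,6,4$; $n\equiv 5\pmod 6$: $6,5,6,1,2,1$.
   Context: For an integer $k$, the poly-Bernoulli numbers with level $2$, $\mathfrak B_n^{(k)}$, are defined by the power series identity $$\sum_{n=0}^\infty\mathfrak B_n^{(k)}\frac{x^n}{n!}=\frac{{\rm Li}_{2,k}\bigl(2\sin(x/2)\bigr)}{2\sin(x/2)}=\sum_{m=0}^\infty\frac{\bigl(2\sin(x/2)\bigr)^{2m}}{(2m+1)^k},$$ where ${\rm Li}_{2,k}(z)=\sum_{n=0}^\infty\frac{z^{2n+1}}{(2n+1)^k}$. For $k\le 0$ these numbers are integers. -}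

module Defs where

open import Data.Nat as ℕ using (ℕ; zero; suc)
open import Data.Nat.Combinatorics using (_C_)
open import Data.Integer as ℤ using (ℤ; +_; -_)
open import Data.List using (List; map; foldr; upTo)

sumℤ : List ℤ → ℤ
sumℤ = foldr ℤ._+_ (+ 0)

Σ≤ : ℕ → (ℕ → ℤ) → ℤ
Σ≤ n f = sumℤ (map f (upTo (suc n)))

-- An exponential generating function with integer coefficients is
-- represented by its coefficient sequence: f ↔ Σ f n x^n / n!.
EGF : Set
EGF = ℕ → ℤ

egfMul : EGF → EGF → EGF
egfMul f g n = Σ≤ n (λ i → (+ (n C i)) ℤ.* (f i ℤ.* g (n ℕ.∸ i)))

egfOne : EGF
egfOne zero    = + 1
egfOne (suc _) = + 0

cosCoef : EGF
cosCoef zero          = + 1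
cosCoef (suc zero)    = + 0
cosCoef (suc (suc n)) = - cosCoef n

-- (2 sin(x/2))^2 = 2 - 2 cos x, as an EGF.
sinSq : EGF
sinSq n = ℤ._-_ (ℤ._*_ (+ 2) (egfOne n)) (ℤ._*_ (+ 2) (cosCoef n))

sinSqPow : ℕ → EGF
sinSqPow zero    = egfOne
sinSqPow (suc m) = egfMul sinSq (sinSqPow m)

-- Poly-Bernoulli numbers with level 2 and index -k (k ≥ 0):
--   Σ_n 𝔅_n^{(-k)} x^n/n! = Σ_m (2 sin(x/2))^{2m} (2m+1)^k.
-- Since (2 sin(x/2))^{2m} = O(x^{2m}), only m ≤ n contribute to x^n.
polyBernLevel2Neg : (k n : ℕ) → ℤ
polyBernLevel2Neg k n =
  Σ≤ n (λ m → sinSqPow m n ℤ.* ((+ (2 ℕ.* m ℕ.+ 1)) ℤ.^ k))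

table : ℕ → ℕ → ℕ
table 0 0 = 6
table 0 1 = 6
table 0 2 = 0
table 0 3 = 1
table 0 4 = 1
table 0 5 = 0
table 1 0 = 2
table 1 1 = 6
table 1 2 = 4
table 1 3 = 5
table 1 4 = 1
table 1 5 = 3
table 2 0 = 1
table 2 1 = 2
table 2 2 = 1
table 2 3 = 6
table 2 4 = 5
table 2 5 = 6
table 3 0 = 1
table 3 1 = 1
table 3 2 = 0
table 3 3 = 6
table 3 4 = 6
table 3 5 = 0
table 4 0 = 5
table 4 1 = 1
table 4 2 = 3
table 4 3 = 2
table 4 4 = 6
table 4 5 = 4
table 5 0 = 6
table 5 1 = 5
table 5 2 = 6
table 5 3 = 1
table 5 4 = 2
table 5 5 = 1
table _ _ = 0

-- With s = 2 sin(x/2), the EGF s^(2m) = (2 − 2 cos x)^m is a combination of the cos(jx),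
-- |j| ≤ m, obtained by iterating 2 cos x cos(jx) = cos((j+1)x) + cos((j−1)x); the product-to-sum
-- formulas are proved on coefficient sequences by induction, through the Leibniz rule for the
-- binomial convolution. As cos(jx) has x^(2n)-coefficient (−1)^n j^(2n), modulo 7 only the terms
-- m = 1, 2 of 𝔅_{2n}^(−k) = Σ_m [x^(2n)] s^(2m) (2m+1)^k survive for n, k ≥ 1: the term m = 0
-- vanishes, the term m = 3 carries 7^k, and s^8 ≡ 0 coefficientwise because 7 divides C(8, j) for
-- 2 ≤ j ≤ 6 while 4² ≡ 3². The survivors add up to (−1)^n ((2·4^n − 8)·5^k − 2·3^k), which by
-- Fermat's little theorem has period 6 in n and in k, and the table lists its residues.

module Submission where

open import Defs

module ExponentialGeneratingFunctions where
  open import Function using (id; _∘_)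
  open import Data.Nat as ℕ using (ℕ; zero; suc; _∸_; _<_; z≤n; s≤s)
  import Data.Nat.Properties as ℕ
  open import Data.Nat.Combinatorics using (_C_; k>n⇒nCk≡0; nCk+nC[k+1]≡[n+1]C[k+1])
  open import Data.Integer using (ℤ; +_; -_; _+_; _-_; _*_; _^_; 0ℤ; 1ℤ; -1ℤ)
  import Data.Integer.Properties as ℤ
  open import Data.Integer.Divisibility.Signed using (_∣_; divides; ∣m∣n⇒∣m+n; ∣n⇒∣m*n)
  open import Data.Integer.Tactic.RingSolver using (solve-∀)
  open import Data.List using (List; []; _∷_; applyUpTo; upTo)
  open import Data.List.Properties using (map-applyUpTo; map-cong)
  open import Relation.Binary.PropositionalEquality
  open ≡-Reasoning

  Σ< : ℕ → (ℕ → ℤ) → ℤ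
  Σ< n f = sumℤ (applyUpTo f n)

  Σ≤≡Σ< : ∀ n f → Σ≤ n f ≡ Σ< (suc n) f
  Σ≤≡Σ< n f = cong sumℤ (map-applyUpTo id f (suc n))

  Σ<-cong : ∀ n {f g : ℕ → ℤ} → (∀ {i} → i < n → f i ≡ g i) → Σ< n f ≡ Σ< n g
  Σ<-cong zero    f≡g = refl
  Σ<-cong (suc n) f≡g = cong₂ _+_ (f≡g (s≤s z≤n)) (Σ<-cong n (f≡g ∘ s≤s))

  Σ<-zero : ∀ n {f : ℕ → ℤ} → (∀ i → f i ≡ 0ℤ) → Σ< n f ≡ 0ℤ
  Σ<-zero zero    f≡0 = refl
  Σ<-zero (suc n) f≡0 = cong₂ _+_ (f≡0 0) (Σ<-zero n (f≡0 ∘ suc))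

  Σ<-+ : ∀ n (f g : ℕ → ℤ) → Σ< n (λ i → f i + g i) ≡ Σ< n f + Σ< n g
  Σ<-+ zero    f g = refl
  Σ<-+ (suc n) f g = begin
    f 0 + g 0 + Σ< n (λ i → f (suc i) + g (suc i))
      ≡⟨ cong (_+_ (f 0 + g 0)) (Σ<-+ n (f ∘ suc) (g ∘ suc)) ⟩
    f 0 + g 0 + (Σ< n (f ∘ suc) + Σ< n (g ∘ suc))
      ≡⟨ interchange (f 0) (g 0) (Σ< n (f ∘ suc)) (Σ< n (g ∘ suc)) ⟩
    f 0 + Σ< n (f ∘ suc) + (g 0 + Σ< n (g ∘ suc)) ∎
    where
    interchange : ∀ a b c d → a + b + (c + d) ≡ a + c + (b + d)
    interchange = solve-∀

  Σ<-* : ∀ n c (f : ℕ → ℤ) → Σ< n (λ i → c * f i) ≡ c * Σ< n f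
  Σ<-* zero    c f = sym (ℤ.*-zeroʳ c)
  Σ<-* (suc n) c f = trans (cong (_+_ (c * f 0)) (Σ<-* n c (f ∘ suc))) (sym (ℤ.*-distribˡ-+ c (f 0) _))

  Σ<-suc : ∀ n (f : ℕ → ℤ) → Σ< (suc n) f ≡ Σ< n f + f n
  Σ<-suc zero    f = ℤ.+-comm (f 0) 0ℤ
  Σ<-suc (suc n) f = trans (cong (_+_ (f 0)) (Σ<-suc n (f ∘ suc))) (sym (ℤ.+-assoc (f 0) _ _))

  Σ<-∣ : ∀ n {d} {f : ℕ → ℤ} → (∀ i → d ∣ f i) → d ∣ Σ< n f
  Σ<-∣ zero    d∣f = divides 0ℤ refl
  Σ<-∣ (suc n) d∣f = ∣m∣n⇒∣m+n (d∣f 0) (Σ<-∣ n (d∣f ∘ suc))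

  infixl 7 _⊛_
  _⊛_ : EGF → EGF → EGF
  _⊛_ = egfMul

  ∂ : EGF → EGF
  ∂ f n = f (suc n)

  binomialTerm : EGF → EGF → ℕ → ℕ → ℤ
  binomialTerm f g n i = + (n C i) * (f i * g (n ∸ i))

  ⊛-Σ< : ∀ f g n → (f ⊛ g) n ≡ Σ< (suc n) (binomialTerm f g n)
  ⊛-Σ< f g n = Σ≤≡Σ< n (binomialTerm f g n)

  ⊛-cong : ∀ {f f′ g g′} → f ≗ f′ → g ≗ g′ → f ⊛ g ≗ f′ ⊛ g′
  ⊛-cong f≗f′ g≗g′ n =
    cong sumℤ (map-cong (λ i → cong₂ (λ x y → + (n C i) * (x * y)) (f≗f′ i) (g≗g′ (n ∸ i)))
                        (upTo (suc n)))

  ⊛-termwise-+ : ∀ F G f g h k n →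
                 (∀ i → binomialTerm F G n i ≡ binomialTerm f g n i + binomialTerm h k n i) →
                 (F ⊛ G) n ≡ (f ⊛ g) n + (h ⊛ k) n
  ⊛-termwise-+ F G f g h k n split = begin
    (F ⊛ G) n
      ≡⟨ ⊛-Σ< F G n ⟩
    Σ< (suc n) (binomialTerm F G n)
      ≡⟨ Σ<-cong (suc n) (λ {i} _ → split i) ⟩
    Σ< (suc n) (λ i → binomialTerm f g n i + binomialTerm h k n i)
      ≡⟨ Σ<-+ (suc n) (binomialTerm f g n) (binomialTerm h k n) ⟩
    Σ< (suc n) (binomialTerm f g n) + Σ< (suc n) (binomialTerm h k n)
      ≡⟨ cong₂ _+_ (⊛-Σ< f g n) (⊛-Σ< h k n) ⟨
    (f ⊛ g) n + (h ⊛ k) n ∎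

  ⊛-termwise-* : ∀ F G c f g n → (∀ i → binomialTerm F G n i ≡ c * binomialTerm f g n i) →
                 (F ⊛ G) n ≡ c * (f ⊛ g) n
  ⊛-termwise-* F G c f g n scale = begin
    (F ⊛ G) n                                ≡⟨ ⊛-Σ< F G n ⟩
    Σ< (suc n) (binomialTerm F G n)          ≡⟨ Σ<-cong (suc n) (λ {i} _ → scale i) ⟩
    Σ< (suc n) (λ i → c * binomialTerm f g n i) ≡⟨ Σ<-* (suc n) c (binomialTerm f g n) ⟩
    c * Σ< (suc n) (binomialTerm f g n)      ≡⟨ cong (c *_) (⊛-Σ< f g n) ⟨
    c * (f ⊛ g) n                            ∎

  ⊛-+ˡ : ∀ f h g n → ((λ i → f i + h i) ⊛ g) n ≡ (f ⊛ g) n + (h ⊛ g) n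
  ⊛-+ˡ f h g n = ⊛-termwise-+ (λ i → f i + h i) g f g h g n
    (λ i → distrib (+ (n C i)) (f i) (h i) (g (n ∸ i)))
    where
    distrib : ∀ b x y z → b * ((x + y) * z) ≡ b * (x * z) + b * (y * z)
    distrib = solve-∀

  ⊛-+ʳ : ∀ f g h n → (f ⊛ (λ i → g i + h i)) n ≡ (f ⊛ g) n + (f ⊛ h) n
  ⊛-+ʳ f g h n = ⊛-termwise-+ f (λ i → g i + h i) f g f h n
    (λ i → distrib (+ (n C i)) (f i) (g (n ∸ i)) (h (n ∸ i)))
    where
    distrib : ∀ b x y z → b * (x * (y + z)) ≡ b * (x * y) + b * (x * z)
    distrib = solve-∀

  ⊛-*ˡ : ∀ c f g n → ((λ i → c * f i) ⊛ g) n ≡ c * (f ⊛ g) n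
  ⊛-*ˡ c f g n = ⊛-termwise-* (λ i → c * f i) g c f g n
    (λ i → commute c (+ (n C i)) (f i) (g (n ∸ i)))
    where
    commute : ∀ c b x y → b * ((c * x) * y) ≡ c * (b * (x * y))
    commute = solve-∀

  ⊛-*ʳ : ∀ c f g n → (f ⊛ (λ i → c * g i)) n ≡ c * (f ⊛ g) n
  ⊛-*ʳ c f g n = ⊛-termwise-* f (λ i → c * g i) c f g n
    (λ i → commute c (+ (n C i)) (f i) (g (n ∸ i)))
    where
    commute : ∀ c b x y → b * (x * (c * y)) ≡ c * (b * (x * y))
    commute = solve-∀

  ⊛-zeroʳ : ∀ f n → (f ⊛ (λ _ → 0ℤ)) n ≡ 0ℤ
  ⊛-zeroʳ f n = trans (⊛-Σ< f (λ _ → 0ℤ) n) (Σ<-zero (suc n) (λ i → annihilate (+ (n C i)) (f i)))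
    where
    annihilate : ∀ b x → b * (x * 0ℤ) ≡ 0ℤ
    annihilate = solve-∀

  ⊛-∣ʳ : ∀ {d} f g n → (∀ i → d ∣ g i) → d ∣ (f ⊛ g) n
  ⊛-∣ʳ f g n d∣g = subst (_ ∣_) (sym (⊛-Σ< f g n))
    (Σ<-∣ (suc n) (λ i → ∣n⇒∣m*n (+ (n C i)) (∣n⇒∣m*n (f i) (d∣g (n ∸ i)))))

  ⊛-leibniz : ∀ f g n → (f ⊛ g) (suc n) ≡ (∂ f ⊛ g) n + (f ⊛ ∂ g) n
  ⊛-leibniz f g n = begin
    (f ⊛ g) (suc n)
      ≡⟨ ⊛-Σ< f g (suc n) ⟩
    t₀ + Σ< (suc n) (λ i → + (suc n C suc i) * X i)
      ≡⟨ cong (_+_ t₀) (Σ<-cong (suc n) (λ {i} _ → pascal i)) ⟩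
    t₀ + Σ< (suc n) (λ i → binomialTerm (∂ f) g n i + r i)
      ≡⟨ cong (_+_ t₀) (Σ<-+ (suc n) (binomialTerm (∂ f) g n) r) ⟩
    t₀ + (Σ< (suc n) (binomialTerm (∂ f) g n) + Σ< (suc n) r)
      ≡⟨ cong (λ x → t₀ + (Σ< (suc n) (binomialTerm (∂ f) g n) + x)) r-drop-last ⟩
    t₀ + (Σ< (suc n) (binomialTerm (∂ f) g n) + Σ< n r)
      ≡⟨ swap t₀ (Σ< (suc n) (binomialTerm (∂ f) g n)) (Σ< n r) ⟩
    Σ< (suc n) (binomialTerm (∂ f) g n) + (t₀ + Σ< n r)
      ≡⟨ cong₂ _+_ (⊛-Σ< (∂ f) g n)
                   (trans (⊛-Σ< f (∂ g) n) (cong (_+_ t₀) (sym (Σ<-cong n r-shift)))) ⟨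
    (∂ f ⊛ g) n + (f ⊛ ∂ g) n ∎
    where
    t₀ : ℤ
    t₀ = binomialTerm f g (suc n) 0
    X : ℕ → ℤ
    X i = f (suc i) * g (n ∸ i)
    r : ℕ → ℤ
    r i = + (n C suc i) * X i
    pascal : ∀ i → + (suc n C suc i) * X i ≡ binomialTerm (∂ f) g n i + r i
    pascal i = begin
      + (suc n C suc i) * X i              ≡⟨ cong (λ m → + m * X i) (nCk+nC[k+1]≡[n+1]C[k+1] n i) ⟨
      + (n C i ℕ.+ n C suc i) * X i        ≡⟨ cong (_* X i) (ℤ.pos-+ (n C i) (n C suc i)) ⟩
      (+ (n C i) + + (n C suc i)) * X i    ≡⟨ ℤ.*-distribʳ-+ (X i) (+ (n C i)) (+ (n C suc i)) ⟩
      binomialTerm (∂ f) g n i + r i       ∎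
    r-drop-last : Σ< (suc n) r ≡ Σ< n r
    r-drop-last = begin
      Σ< (suc n) r      ≡⟨ Σ<-suc n r ⟩
      Σ< n r + r n      ≡⟨ cong (λ m → Σ< n r + + m * X n) (k>n⇒nCk≡0 (ℕ.n<1+n n)) ⟩
      Σ< n r + 0ℤ * X n ≡⟨ cong (_+_ (Σ< n r)) (ℤ.*-zeroˡ (X n)) ⟩
      Σ< n r + 0ℤ       ≡⟨ ℤ.+-identityʳ (Σ< n r) ⟩
      Σ< n r            ∎
    r-shift : ∀ {i} → i < n → r i ≡ binomialTerm f (∂ g) n (suc i)
    r-shift {i} i<n = cong (λ m → + (n C suc i) * (f (suc i) * g m)) (ℕ.+-∸-assoc 1 i<n)
    swap : ∀ a b c → a + (b + c) ≡ b + (a + c)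
    swap = solve-∀

  ⊛-suc : ∀ f g {f′ g′} α β → ∂ f ≗ (λ i → α * f′ i) → ∂ g ≗ (λ i → β * g′ i) →
          ∀ n → (f ⊛ g) (suc n) ≡ α * (f′ ⊛ g) n + β * (f ⊛ g′) n
  ⊛-suc f g {f′} {g′} α β ∂f ∂g n = begin
    (f ⊛ g) (suc n)
      ≡⟨ ⊛-leibniz f g n ⟩
    (∂ f ⊛ g) n + (f ⊛ ∂ g) n
      ≡⟨ cong₂ _+_ (⊛-cong {g = g} ∂f (λ _ → refl) n) (⊛-cong {f} (λ _ → refl) ∂g n) ⟩
    ((λ i → α * f′ i) ⊛ g) n + (f ⊛ (λ i → β * g′ i)) n
      ≡⟨ cong₂ _+_ (⊛-*ˡ α f′ g n) (⊛-*ʳ β f g′ n) ⟩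
    α * (f′ ⊛ g) n + β * (f ⊛ g′) n ∎

  sinCoef : EGF
  sinCoef zero    = 0ℤ
  sinCoef (suc n) = cosCoef n

  cos sin : ℤ → EGF
  cos a n = cosCoef n * a ^ n
  sin a n = sinCoef n * a ^ n

  cosCoef-suc : ∀ n → cosCoef (suc n) ≡ - sinCoef n
  cosCoef-suc zero    = refl
  cosCoef-suc (suc n) = refl

  ∂cos : ∀ a → ∂ (cos a) ≗ (λ n → - a * sin a n)
  ∂cos a n = trans (cong (_* (a * a ^ n)) (cosCoef-suc n)) (rearrange (sinCoef n) a (a ^ n))
    where
    rearrange : ∀ s a p → - s * (a * p) ≡ - a * (s * p)
    rearrange = solve-∀

  ∂sin : ∀ a → ∂ (sin a) ≗ (λ n → a * cos a n)
  ∂sin a n = rearrange (cosCoef n) a (a ^ n)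
    where
    rearrange : ∀ c a p → c * (a * p) ≡ a * (c * p)
    rearrange = solve-∀

  private
    double-combination : ∀ α β x y → + 2 * (α * x + β * y) ≡ α * (+ 2 * x) + β * (+ 2 * y)
    double-combination = solve-∀

  mutual
    cos-⊛-cos : ∀ a b n → + 2 * (cos a ⊛ cos b) n ≡ cos (a + b) n + cos (- a + b) n
    cos-⊛-cos a b zero    = refl
    cos-⊛-cos a b (suc n) = begin
      + 2 * (cos a ⊛ cos b) (suc n)
        ≡⟨ cong (+ 2 *_) (⊛-suc (cos a) (cos b) (- a) (- b) (∂cos a) (∂cos b) n) ⟩
      + 2 * (- a * (sin a ⊛ cos b) n + - b * (cos a ⊛ sin b) n)
        ≡⟨ double-combination (- a) (- b) _ _ ⟩
      - a * (+ 2 * (sin a ⊛ cos b) n) + - b * (+ 2 * (cos a ⊛ sin b) n)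
        ≡⟨ cong₂ (λ x y → - a * x + - b * y) (sin-⊛-cos a b n) (cos-⊛-sin a b n) ⟩
      - a * (sin (a + b) n - sin (- a + b) n) + - b * (sin (a + b) n + sin (- a + b) n)
        ≡⟨ collect a b (sin (a + b) n) (sin (- a + b) n) ⟩
      - (a + b) * sin (a + b) n + - (- a + b) * sin (- a + b) n
        ≡⟨ cong₂ _+_ (∂cos (a + b) n) (∂cos (- a + b) n) ⟨
      cos (a + b) (suc n) + cos (- a + b) (suc n) ∎
      where
      collect : ∀ a b p q → - a * (p - q) + - b * (p + q) ≡ - (a + b) * p + - (- a + b) * q
      collect = solve-∀

    cos-⊛-sin : ∀ a b n → + 2 * (cos a ⊛ sin b) n ≡ sin (a + b) n + sin (- a + b) n
    cos-⊛-sin a b zero    = refl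
    cos-⊛-sin a b (suc n) = begin
      + 2 * (cos a ⊛ sin b) (suc n)
        ≡⟨ cong (+ 2 *_) (⊛-suc (cos a) (sin b) (- a) b (∂cos a) (∂sin b) n) ⟩
      + 2 * (- a * (sin a ⊛ sin b) n + b * (cos a ⊛ cos b) n)
        ≡⟨ double-combination (- a) b _ _ ⟩
      - a * (+ 2 * (sin a ⊛ sin b) n) + b * (+ 2 * (cos a ⊛ cos b) n)
        ≡⟨ cong₂ (λ x y → - a * x + b * y) (sin-⊛-sin a b n) (cos-⊛-cos a b n) ⟩
      - a * (cos (- a + b) n - cos (a + b) n) + b * (cos (a + b) n + cos (- a + b) n)
        ≡⟨ collect a b (cos (a + b) n) (cos (- a + b) n) ⟩
      (a + b) * cos (a + b) n + (- a + b) * cos (- a + b) n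
        ≡⟨ cong₂ _+_ (∂sin (a + b) n) (∂sin (- a + b) n) ⟨
      sin (a + b) (suc n) + sin (- a + b) (suc n) ∎
      where
      collect : ∀ a b p q → - a * (q - p) + b * (p + q) ≡ (a + b) * p + (- a + b) * q
      collect = solve-∀

    sin-⊛-cos : ∀ a b n → + 2 * (sin a ⊛ cos b) n ≡ sin (a + b) n - sin (- a + b) n
    sin-⊛-cos a b zero    = refl
    sin-⊛-cos a b (suc n) = begin
      + 2 * (sin a ⊛ cos b) (suc n)
        ≡⟨ cong (+ 2 *_) (⊛-suc (sin a) (cos b) a (- b) (∂sin a) (∂cos b) n) ⟩
      + 2 * (a * (cos a ⊛ cos b) n + - b * (sin a ⊛ sin b) n)
        ≡⟨ double-combination a (- b) _ _ ⟩
      a * (+ 2 * (cos a ⊛ cos b) n) + - b * (+ 2 * (sin a ⊛ sin b) n)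
        ≡⟨ cong₂ (λ x y → a * x + - b * y) (cos-⊛-cos a b n) (sin-⊛-sin a b n) ⟩
      a * (cos (a + b) n + cos (- a + b) n) + - b * (cos (- a + b) n - cos (a + b) n)
        ≡⟨ collect a b (cos (a + b) n) (cos (- a + b) n) ⟩
      (a + b) * cos (a + b) n - (- a + b) * cos (- a + b) n
        ≡⟨ cong₂ _-_ (∂sin (a + b) n) (∂sin (- a + b) n) ⟨
      sin (a + b) (suc n) - sin (- a + b) (suc n) ∎
      where
      collect : ∀ a b p q → a * (p + q) + - b * (q - p) ≡ (a + b) * p - (- a + b) * q
      collect = solve-∀

    sin-⊛-sin : ∀ a b n → + 2 * (sin a ⊛ sin b) n ≡ cos (- a + b) n - cos (a + b) n
    sin-⊛-sin a b zero    = refl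
    sin-⊛-sin a b (suc n) = begin
      + 2 * (sin a ⊛ sin b) (suc n)
        ≡⟨ cong (+ 2 *_) (⊛-suc (sin a) (sin b) a b (∂sin a) (∂sin b) n) ⟩
      + 2 * (a * (cos a ⊛ sin b) n + b * (sin a ⊛ cos b) n)
        ≡⟨ double-combination a b _ _ ⟩
      a * (+ 2 * (cos a ⊛ sin b) n) + b * (+ 2 * (sin a ⊛ cos b) n)
        ≡⟨ cong₂ (λ x y → a * x + b * y) (cos-⊛-sin a b n) (sin-⊛-cos a b n) ⟩
      a * (sin (a + b) n + sin (- a + b) n) + b * (sin (a + b) n - sin (- a + b) n)
        ≡⟨ collect a b (sin (a + b) n) (sin (- a + b) n) ⟩
      - (- a + b) * sin (- a + b) n - - (a + b) * sin (a + b) n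
        ≡⟨ cong₂ _-_ (∂cos (- a + b) n) (∂cos (a + b) n) ⟨
      cos (- a + b) (suc n) - cos (a + b) (suc n) ∎
      where
      collect : ∀ a b p q → a * (p + q) + b * (p - q) ≡ - (- a + b) * q - - (a + b) * p
      collect = solve-∀

  cos0≗egfOne : cos 0ℤ ≗ egfOne
  cos0≗egfOne zero    = refl
  cos0≗egfOne (suc n) = annihilate (cosCoef (suc n)) (0ℤ ^ n)
    where
    annihilate : ∀ c p → c * (0ℤ * p) ≡ 0ℤ
    annihilate = solve-∀

  cos1≗cosCoef : cos 1ℤ ≗ cosCoef
  cos1≗cosCoef n = trans (cong (cosCoef n *_) (ℤ.^-zeroˡ n)) (ℤ.*-identityʳ (cosCoef n))

  sinSq≗cos : sinSq ≗ (λ n → + 2 * cos 0ℤ n + - + 2 * cos 1ℤ n)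
  sinSq≗cos n = trans (cong₂ (λ e c → + 2 * e - + 2 * c) (sym (cos0≗egfOne n)) (sym (cos1≗cosCoef n)))
                      (rearrange (cos 0ℤ n) (cos 1ℤ n))
    where
    rearrange : ∀ x y → + 2 * x - + 2 * y ≡ + 2 * x + - + 2 * y
    rearrange = solve-∀

  sinSq-⊛-cos : ∀ r n → (sinSq ⊛ cos r) n ≡ + 2 * cos r n - cos (1ℤ + r) n - cos (- 1ℤ + r) n
  sinSq-⊛-cos r n = begin
    (sinSq ⊛ cos r) n
      ≡⟨ ⊛-cong {g = cos r} sinSq≗cos (λ _ → refl) n ⟩
    ((λ i → + 2 * cos 0ℤ i + - + 2 * cos 1ℤ i) ⊛ cos r) n
      ≡⟨ ⊛-+ˡ (λ i → + 2 * cos 0ℤ i) (λ i → - + 2 * cos 1ℤ i) (cos r) n ⟩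
    ((λ i → + 2 * cos 0ℤ i) ⊛ cos r) n + ((λ i → - + 2 * cos 1ℤ i) ⊛ cos r) n
      ≡⟨ cong₂ _+_ (⊛-*ˡ (+ 2) (cos 0ℤ) (cos r) n) (⊛-*ˡ (- + 2) (cos 1ℤ) (cos r) n) ⟩
    + 2 * (cos 0ℤ ⊛ cos r) n + - + 2 * (cos 1ℤ ⊛ cos r) n
      ≡⟨ cong (_+_ (+ 2 * (cos 0ℤ ⊛ cos r) n)) (ℤ.neg-distribˡ-* (+ 2) _) ⟨
    + 2 * (cos 0ℤ ⊛ cos r) n - + 2 * (cos 1ℤ ⊛ cos r) n
      ≡⟨ cong₂ _-_ (trans (cos-⊛-cos 0ℤ r n) (cong (λ s → cos s n + cos s n) (ℤ.+-identityˡ r)))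
                   (cos-⊛-cos 1ℤ r n) ⟩
    cos r n + cos r n - (cos (1ℤ + r) n + cos (- 1ℤ + r) n)
      ≡⟨ rearrange (cos r n) (cos (1ℤ + r) n) (cos (- 1ℤ + r) n) ⟩
    + 2 * cos r n - cos (1ℤ + r) n - cos (- 1ℤ + r) n ∎
    where
    rearrange : ∀ x y z → x + x - (y + z) ≡ + 2 * x - y - z
    rearrange = solve-∀

  -- cosSum r cs is Σⱼ csⱼ cos((r + j) x).
  cosSum : ℤ → List ℤ → EGF
  cosSum r []       n = 0ℤ
  cosSum r (c ∷ cs) n = c * cos r n + cosSum (1ℤ + r) cs n

  infixl 6 _⊞_
  _⊞_ : List ℤ → List ℤ → List ℤ
  []       ⊞ ys       = ys
  (x ∷ xs) ⊞ []       = x ∷ xs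
  (x ∷ xs) ⊞ (y ∷ ys) = x + y ∷ xs ⊞ ys

  cosSum-⊞ : ∀ r xs ys n → cosSum r (xs ⊞ ys) n ≡ cosSum r xs n + cosSum r ys n
  cosSum-⊞ r []       ys       n = sym (ℤ.+-identityˡ _)
  cosSum-⊞ r (x ∷ xs) []       n = sym (ℤ.+-identityʳ _)
  cosSum-⊞ r (x ∷ xs) (y ∷ ys) n =
    trans (cong (_+_ ((x + y) * cos r n)) (cosSum-⊞ (1ℤ + r) xs ys n))
          (interchange x y (cos r n) (cosSum (1ℤ + r) xs n) (cosSum (1ℤ + r) ys n))
    where
    interchange : ∀ x y c p q → (x + y) * c + (p + q) ≡ x * c + p + (y * c + q)
    interchange = solve-∀

  -- (2 − 2 cos x) cos(jx) = 2 cos(jx) − cos((j+1)x) − cos((j−1)x): the coefficients are convolved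
  -- with (−1, 2, −1) and the lowest frequency drops by one.
  timesSinSq : List ℤ → List ℤ
  timesSinSq []       = []
  timesSinSq (c ∷ cs) = - c ∷ (+ 2 * c ∷ - c ∷ []) ⊞ timesSinSq cs

  sinSq-⊛-cosSum : ∀ r cs n → (sinSq ⊛ cosSum (1ℤ + r) cs) n ≡ cosSum r (timesSinSq cs) n
  sinSq-⊛-cosSum r []       n = ⊛-zeroʳ sinSq n
  sinSq-⊛-cosSum r (c ∷ cs) n = begin
    (sinSq ⊛ cosSum (1ℤ + r) (c ∷ cs)) n
      ≡⟨ ⊛-+ʳ sinSq (λ i → c * cos (1ℤ + r) i) (cosSum (1ℤ + (1ℤ + r)) cs) n ⟩
    (sinSq ⊛ (λ i → c * cos (1ℤ + r) i)) n + (sinSq ⊛ cosSum (1ℤ + (1ℤ + r)) cs) n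
      ≡⟨ cong₂ _+_ (trans (⊛-*ʳ c sinSq (cos (1ℤ + r)) n) (cong (c *_) (sinSq-⊛-cos (1ℤ + r) n)))
                   (sinSq-⊛-cosSum (1ℤ + r) cs n) ⟩
    c * (+ 2 * cos (1ℤ + r) n - cos (1ℤ + (1ℤ + r)) n - cos (- 1ℤ + (1ℤ + r)) n) + S
      ≡⟨ cong (λ s → c * (+ 2 * cos (1ℤ + r) n - cos (1ℤ + (1ℤ + r)) n - cos s n) + S) (pred-suc r) ⟩
    c * (+ 2 * cos (1ℤ + r) n - cos (1ℤ + (1ℤ + r)) n - cos r n) + S
      ≡⟨ rearrange c (cos r n) (cos (1ℤ + r) n) (cos (1ℤ + (1ℤ + r)) n) S ⟩
    - c * cos r n + ((+ 2 * c * cos (1ℤ + r) n + (- c * cos (1ℤ + (1ℤ + r)) n + 0ℤ)) + S)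
      ≡⟨ cong (_+_ (- c * cos r n)) (cosSum-⊞ (1ℤ + r) (+ 2 * c ∷ - c ∷ []) (timesSinSq cs) n) ⟨
    cosSum r (timesSinSq (c ∷ cs)) n ∎
    where
    S : ℤ
    S = cosSum (1ℤ + r) (timesSinSq cs) n
    pred-suc : ∀ r → - 1ℤ + (1ℤ + r) ≡ r
    pred-suc = solve-∀
    rearrange : ∀ c x₀ x₁ x₂ s →
      c * (+ 2 * x₁ - x₂ - x₀) + s ≡ - c * x₀ + ((+ 2 * c * x₁ + (- c * x₂ + 0ℤ)) + s)
    rearrange = solve-∀

  sinSqCoeffs : ℕ → List ℤ
  sinSqCoeffs zero    = 1ℤ ∷ []
  sinSqCoeffs (suc m) = timesSinSq (sinSqCoeffs m)

  sinSqPow≗cosSum : ∀ m → sinSqPow m ≗ cosSum (- + m) (sinSqCoeffs m)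
  sinSqPow≗cosSum zero    n = trans (sym (cos0≗egfOne n)) (unit (cos 0ℤ n))
    where
    unit : ∀ x → x ≡ 1ℤ * x + 0ℤ
    unit = solve-∀
  sinSqPow≗cosSum (suc m) n = begin
    (sinSq ⊛ sinSqPow m) n
      ≡⟨ ⊛-cong {sinSq} (λ _ → refl) (sinSqPow≗cosSum m) n ⟩
    (sinSq ⊛ cosSum (- + m) (sinSqCoeffs m)) n
      ≡⟨ cong (λ r → (sinSq ⊛ cosSum r (sinSqCoeffs m)) n) (suc-neg (+ m)) ⟨
    (sinSq ⊛ cosSum (1ℤ + - + suc m) (sinSqCoeffs m)) n
      ≡⟨ sinSq-⊛-cosSum (- + suc m) (sinSqCoeffs m) n ⟩
    cosSum (- + suc m) (sinSqCoeffs (suc m)) n ∎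
    where
    suc-neg : ∀ x → 1ℤ + - (1ℤ + x) ≡ - x
    suc-neg = solve-∀

  cos-even : ∀ r n → cos r (2 ℕ.* n) ≡ -1ℤ ^ n * (r * r) ^ n
  cos-even r zero    = refl
  cos-even r (suc n) = begin
    cos r (2 ℕ.* suc n)                           ≡⟨ cong (cos r) (ℕ.*-suc 2 n) ⟩
    - cosCoef (2 ℕ.* n) * (r * (r * r ^ (2 ℕ.* n))) ≡⟨ rearrange (cosCoef (2 ℕ.* n)) r (r ^ (2 ℕ.* n)) ⟩
    -1ℤ * (r * r) * cos r (2 ℕ.* n)               ≡⟨ cong (-1ℤ * (r * r) *_) (cos-even r n) ⟩
    -1ℤ * (r * r) * (-1ℤ ^ n * (r * r) ^ n)       ≡⟨ interchange -1ℤ (r * r) (-1ℤ ^ n) ((r * r) ^ n) ⟩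
    -1ℤ ^ suc n * (r * r) ^ suc n                 ∎
    where
    rearrange : ∀ c r p → - c * (r * (r * p)) ≡ -1ℤ * (r * r) * (c * p)
    rearrange = solve-∀
    interchange : ∀ a b c d → a * b * (c * d) ≡ a * c * (b * d)
    interchange = solve-∀

  evenPowerSum : ℤ → List ℤ → ℕ → ℤ
  evenPowerSum r []       n = 0ℤ
  evenPowerSum r (c ∷ cs) n = c * (r * r) ^ n + evenPowerSum (1ℤ + r) cs n

  cosSum-even : ∀ r cs n → cosSum r cs (2 ℕ.* n) ≡ -1ℤ ^ n * evenPowerSum r cs n
  cosSum-even r []       n = sym (ℤ.*-zeroʳ (-1ℤ ^ n))
  cosSum-even r (c ∷ cs) n =
    trans (cong₂ (λ x y → c * x + y) (cos-even r n) (cosSum-even (1ℤ + r) cs n))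
          (factor c (-1ℤ ^ n) ((r * r) ^ n) (evenPowerSum (1ℤ + r) cs n))
    where
    factor : ∀ c s p e → c * (s * p) + s * e ≡ s * (c * p + e)
    factor = solve-∀

module Congruences where
  open import Data.Nat as ℕ using (ℕ; zero; suc; _<_)
  import Data.Nat.Properties as ℕ
  open import Data.Nat.DivMod using (m≡m%n+[m/n]*n; m<n⇒m%n≡m)
  open import Data.Nat.Divisibility as ℕ using (n∣m⇒m%n≡0)
  open import Data.Integer using (ℤ; +_; -_; _+_; _-_; _*_; _^_; 0ℤ; 1ℤ; ∣_∣)
  import Data.Integer.Properties as ℤ
  open import Data.Integer.DivMod using (_%ℕ_; _/ℕ_; n%ℕd<d; a≡a%ℕn+[a/ℕn]*n)
  open import Data.Integer.Divisibility.Signed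
    using (_∣_; divides; ∣⇒∣ᵤ; ∣m∣n⇒∣m+n; ∣m⇒∣-m; ∣n⇒∣m*n)
  open import Data.Integer.Tactic.RingSolver using (solve-∀)
  open import Data.Sum using (inj₁; inj₂)
  open import Relation.Binary.PropositionalEquality
  open ≡-Reasoning
  open ExponentialGeneratingFunctions using (cos)

  infix 4 _≡_mod_
  record _≡_mod_ (x y d : ℤ) : Set where
    constructor ∣-difference
    field
      divides-difference : d ∣ x - y

  open _≡_mod_ public

  ≡-mod-refl : ∀ {d} x → x ≡ x mod d
  ≡-mod-refl x = ∣-difference (subst (_ ∣_) (sym (ℤ.+-inverseʳ x)) (divides 0ℤ refl))

  ≡-mod-sym : ∀ {d x y} → x ≡ y mod d → y ≡ x mod d
  ≡-mod-sym {x = x} {y} (∣-difference d∣x-y) =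
    ∣-difference (subst (_ ∣_) (negate x y) (∣m⇒∣-m d∣x-y))
    where
    negate : ∀ x y → - (x - y) ≡ y - x
    negate = solve-∀

  ≡-mod-trans : ∀ {d x y z} → x ≡ y mod d → y ≡ z mod d → x ≡ z mod d
  ≡-mod-trans {x = x} {y} {z} (∣-difference d∣x-y) (∣-difference d∣y-z) =
    ∣-difference (subst (_ ∣_) (telescope x y z) (∣m∣n⇒∣m+n d∣x-y d∣y-z))
    where
    telescope : ∀ x y z → x - y + (y - z) ≡ x - z
    telescope = solve-∀

  ≡-mod-periodic : ∀ {d} p .{{_ : ℕ.NonZero p}} (f : ℕ → ℤ) →
                   (∀ n → f (p ℕ.+ n) ≡ f n mod d) → ∀ n → f n ≡ f (n ℕ.% p) mod d
  ≡-mod-periodic {d} p f step n =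
    subst (λ m → f m ≡ f (n ℕ.% p) mod d)
          (sym (trans (m≡m%n+[m/n]*n n p) (ℕ.+-comm (n ℕ.% p) _)))
          (shift (n ℕ./ p) (n ℕ.% p))
    where
    shift : ∀ q r → f (q ℕ.* p ℕ.+ r) ≡ f r mod d
    shift zero    r = ≡-mod-refl (f r)
    shift (suc q) r = ≡-mod-trans
      (subst (λ m → f m ≡ f (q ℕ.* p ℕ.+ r) mod d) (sym (ℕ.+-assoc p (q ℕ.* p) r))
             (step (q ℕ.* p ℕ.+ r)))
      (shift q r)

  private
    residue-unique-≤ : ∀ {d r s} .{{_ : ℕ.NonZero d}} → r ℕ.≤ s → s < d → + r ≡ + s mod + d → r ≡ s
    residue-unique-≤ {d} {r} {s} r≤s s<d (∣-difference d∣r-s) = ℕ.≤-antisym r≤s (ℕ.m∸n≡0⇒m≤n (begin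
      s ℕ.∸ r          ≡⟨ m<n⇒m%n≡m (ℕ.≤-<-trans (ℕ.m∸n≤m s r) s<d) ⟨
      (s ℕ.∸ r) ℕ.% d  ≡⟨ n∣m⇒m%n≡0 (s ℕ.∸ r) d d∣s∸r ⟩
      0                ∎))
      where
      d∣s∸r : d ℕ.∣ s ℕ.∸ r
      d∣s∸r = subst (d ℕ.∣_) (trans (cong ∣_∣ (ℤ.m-n≡m⊖n r s)) (ℤ.∣⊖∣-≤ r≤s)) (∣⇒∣ᵤ d∣r-s)

  residue-unique : ∀ {d r s} .{{_ : ℕ.NonZero d}} → r < d → s < d → + r ≡ + s mod + d → r ≡ s
  residue-unique {r = r} {s} r<d s<d r≡s with ℕ.≤-total r s
  ... | inj₁ r≤s = residue-unique-≤ r≤s s<d r≡s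
  ... | inj₂ s≤r = sym (residue-unique-≤ s≤r r<d (≡-mod-sym r≡s))

  %ℕ-≡-mod : ∀ x d .{{_ : ℕ.NonZero d}} → + (x %ℕ d) ≡ x mod + d
  %ℕ-≡-mod x d = ∣-difference (divides (- (x /ℕ d)) (begin
    + (x %ℕ d) - x                              ≡⟨ cong (_-_ (+ (x %ℕ d))) (a≡a%ℕn+[a/ℕn]*n x d) ⟩
    + (x %ℕ d) - (+ (x %ℕ d) + x /ℕ d * + d)    ≡⟨ cancel (+ (x %ℕ d)) (x /ℕ d) (+ d) ⟩
    - (x /ℕ d) * + d                            ∎))
    where
    cancel : ∀ r q d → r - (r + q * d) ≡ - q * d
    cancel = solve-∀

  %ℕ-cong : ∀ {x y} d .{{_ : ℕ.NonZero d}} → x ≡ y mod + d → x %ℕ d ≡ y %ℕ d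
  %ℕ-cong {x} {y} d x≡y = residue-unique (n%ℕd<d x d) (n%ℕd<d y d)
    (≡-mod-trans (%ℕ-≡-mod x d) (≡-mod-trans x≡y (≡-mod-sym (%ℕ-≡-mod y d))))

  cos-≡-mod : ∀ {d a b} → a * a ≡ b * b mod d → ∀ n → cos a n ≡ cos b n mod d
  cos-≡-mod _ zero = ≡-mod-refl 1ℤ
  cos-≡-mod {d} {a} {b} _ (suc zero) = ∣-difference (subst (d ∣_) (sym (vanish a b)) (divides 0ℤ refl))
    where
    vanish : ∀ a b → 0ℤ * (a * 1ℤ) - 0ℤ * (b * 1ℤ) ≡ 0ℤ
    vanish = solve-∀
  cos-≡-mod {d} {a} {b} a²≡b²@(∣-difference d∣a²-b²) (suc (suc n)) =
    ∣-difference (subst (d ∣_) (sym (split (cosCoef n) a b (a ^ n) (b ^ n)))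
      (∣m∣n⇒∣m+n (∣n⇒∣m*n (- cos a n) d∣a²-b²)
                 (∣n⇒∣m*n (- (b * b)) (divides-difference (cos-≡-mod a²≡b² n)))))
    where
    split : ∀ c a b p q → - c * (a * (a * p)) - - c * (b * (b * q))
                          ≡ - (c * p) * (a * a - b * b) + - (b * b) * (c * p - c * q)
    split = solve-∀

module PolyBernoulliModSeven where
  open import Data.Nat as ℕ using (ℕ; zero; suc; _<_; s≤s)
  import Data.Nat.Properties as ℕ
  open import Data.Integer using (ℤ; +_; -_; _+_; _-_; _*_; _^_; 0ℤ; 1ℤ; -1ℤ)
  import Data.Integer.Properties as ℤ
  open import Data.Integer.DivMod using (_%ℕ_)
  open import Data.Integer.Divisibility.Signed
    using (_∣_; divides; ∣-refl; ∣m∣n⇒∣m+n; ∣n⇒∣m*n; ∣m⇒∣m*n)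
  open import Data.Integer.Tactic.RingSolver using (solve-∀)
  open import Data.List using ([]; _∷_)
  open import Data.List.Properties using (map-applyUpTo)
  open import Relation.Nullary.Decidable using (toWitness)
  open import Data.Unit using (tt)
  open import Relation.Binary.PropositionalEquality
  open ≡-Reasoning
  open ExponentialGeneratingFunctions
  open Congruences

  sinSqCoeffs-4 : sinSqCoeffs 4 ≡ 1ℤ ∷ - + 8 ∷ + 28 ∷ - + 56 ∷ + 70 ∷ - + 56 ∷ + 28 ∷ - + 8 ∷ 1ℤ ∷ []
  sinSqCoeffs-4 = refl

  sinSqPow-4-divisible : ∀ n → + 7 ∣ sinSqPow 4 n
  sinSqPow-4-divisible n = subst (+ 7 ∣_) (sym expansion)
    (∣m∣n⇒∣m+n (∣m∣n⇒∣m+n (divides-difference (cos-≡-mod {a = - + 4} {b = - + 3} (∣-difference ∣-refl) n))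
                          (divides-difference (cos-≡-mod {a = + 4} {b = + 3} (∣-difference ∣-refl) n)))
               (∣m⇒∣m*n _ ∣-refl))
    where
    regroup : ∀ y₋₄ y₋₃ y₋₂ y₋₁ y₀ y₁ y₂ y₃ y₄ →
      1ℤ * y₋₄ + (- + 8 * y₋₃ + (+ 28 * y₋₂ + (- + 56 * y₋₁ + (+ 70 * y₀ +
        (- + 56 * y₁ + (+ 28 * y₂ + (- + 8 * y₃ + (1ℤ * y₄ + 0ℤ))))))))
      ≡ (y₋₄ - y₋₃) + (y₄ - y₃)
        + + 7 * (+ 4 * y₋₂ - + 8 * y₋₁ + + 10 * y₀ - + 8 * y₁ + + 4 * y₂ - y₋₃ - y₃)
    regroup = solve-∀
    expansion : sinSqPow 4 n ≡ (cos (- + 4) n - cos (- + 3) n) + (cos (+ 4) n - cos (+ 3) n) + + 7 *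
      (+ 4 * cos (- + 2) n - + 8 * cos -1ℤ n + + 10 * cos 0ℤ n - + 8 * cos 1ℤ n + + 4 * cos (+ 2) n
        - cos (- + 3) n - cos (+ 3) n)
    expansion = begin
      sinSqPow 4 n
        ≡⟨ sinSqPow≗cosSum 4 n ⟩
      cosSum (- + 4) (sinSqCoeffs 4) n
        ≡⟨ cong (λ cs → cosSum (- + 4) cs n) sinSqCoeffs-4 ⟩
      cosSum (- + 4) (1ℤ ∷ - + 8 ∷ + 28 ∷ - + 56 ∷ + 70 ∷ - + 56 ∷ + 28 ∷ - + 8 ∷ 1ℤ ∷ []) n
        ≡⟨ regroup (cos (- + 4) n) (cos (- + 3) n) (cos (- + 2) n) (cos -1ℤ n) (cos 0ℤ n)
                   (cos 1ℤ n) (cos (+ 2) n) (cos (+ 3) n) (cos (+ 4) n) ⟩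
      (cos (- + 4) n - cos (- + 3) n) + (cos (+ 4) n - cos (+ 3) n) + + 7 *
        (+ 4 * cos (- + 2) n - + 8 * cos -1ℤ n + + 10 * cos 0ℤ n - + 8 * cos 1ℤ n + + 4 * cos (+ 2) n
          - cos (- + 3) n - cos (+ 3) n) ∎

  sinSqPow-divisible : ∀ j n → + 7 ∣ sinSqPow (4 ℕ.+ j) n
  sinSqPow-divisible zero    n = sinSqPow-4-divisible n
  sinSqPow-divisible (suc j) n = ⊛-∣ʳ sinSq (sinSqPow (4 ℕ.+ j)) n (sinSqPow-divisible j)

  polyBern-≡-first-terms : ∀ {L} k → 2 ℕ.≤ L →
    polyBernLevel2Neg (suc k) L ≡ sinSqPow 1 L * (+ 3) ^ suc k + sinSqPow 2 L * (+ 5) ^ suc k mod + 7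
  polyBern-≡-first-terms {L@(suc (suc N))} k (s≤s (s≤s _)) =
    ∣-difference (subst (+ 7 ∣_) (sym difference) (Σ<-∣ N higher-divisible))
    where
    h : ℕ → ℤ
    h m = sinSqPow m L * (+ (2 ℕ.* m ℕ.+ 1)) ^ suc k
    higher-divisible : ∀ j → + 7 ∣ h (3 ℕ.+ j)
    higher-divisible zero    = ∣n⇒∣m*n (sinSqPow 3 L) (∣m⇒∣m*n ((+ 7) ^ k) ∣-refl)
    higher-divisible (suc j) = ∣m⇒∣m*n _ (sinSqPow-divisible j L)
    difference : polyBernLevel2Neg (suc k) L - (h 1 + h 2) ≡ Σ< N (λ j → h (3 ℕ.+ j))
    difference = begin
      polyBernLevel2Neg (suc k) L - (h 1 + h 2)
        ≡⟨ cong (λ t → h 0 + (h 1 + (h 2 + sumℤ t)) - (h 1 + h 2)) (map-applyUpTo (λ j → 3 ℕ.+ j) h N) ⟩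
      h 0 + (h 1 + (h 2 + Σ< N (λ j → h (3 ℕ.+ j)))) - (h 1 + h 2)
        ≡⟨ cong (λ t → t + (h 1 + (h 2 + Σ< N (λ j → h (3 ℕ.+ j)))) - (h 1 + h 2))
                (ℤ.*-zeroˡ (1ℤ ^ suc k)) ⟩
      0ℤ + (h 1 + (h 2 + Σ< N (λ j → h (3 ℕ.+ j)))) - (h 1 + h 2)
        ≡⟨ cancel (h 1) (h 2) (Σ< N (λ j → h (3 ℕ.+ j))) ⟩
      Σ< N (λ j → h (3 ℕ.+ j)) ∎
      where
      cancel : ∀ x y z → 0ℤ + (x + (y + z)) - (x + y) ≡ z
      cancel = solve-∀

  sinSqPow-even : ∀ m n → sinSqPow m (2 ℕ.* n) ≡ -1ℤ ^ n * evenPowerSum (- + m) (sinSqCoeffs m) n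
  sinSqPow-even m n = trans (sinSqPow≗cosSum m (2 ℕ.* n)) (cosSum-even (- + m) (sinSqCoeffs m) n)

  evenPowerSum-1 : ∀ n → evenPowerSum (- 1ℤ) (sinSqCoeffs 1) (suc n) ≡ - + 2
  evenPowerSum-1 n = trans (collapse (1ℤ ^ n) (0ℤ ^ n)) (cong (- + 2 *_) (ℤ.^-zeroˡ n))
    where
    collapse : ∀ o z → - 1ℤ * (1ℤ * o) + (+ 2 * (0ℤ * z) + (- 1ℤ * (1ℤ * o) + 0ℤ)) ≡ - + 2 * o
    collapse = solve-∀

  evenPowerSum-2 : ∀ n → evenPowerSum (- + 2) (sinSqCoeffs 2) (suc n) ≡ + 2 * (+ 4) ^ suc n - + 8
  evenPowerSum-2 n = trans (collapse ((+ 4) ^ n) (1ℤ ^ n) (0ℤ ^ n))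
                           (cong (λ o → + 2 * (+ 4) ^ suc n - + 8 * o) (ℤ.^-zeroˡ n))
    where
    collapse : ∀ f o z →
      1ℤ * (+ 4 * f) + (- + 4 * (1ℤ * o) + (+ 6 * (0ℤ * z) + (- + 4 * (1ℤ * o) + (1ℤ * (+ 4 * f) + 0ℤ))))
      ≡ + 2 * (+ 4 * f) - + 8 * o
    collapse = solve-∀

  closedForm : ℕ → ℕ → ℤ
  closedForm n k = -1ℤ ^ n * ((+ 2 * (+ 4) ^ n - + 8) * (+ 5) ^ k - + 2 * (+ 3) ^ k)

  first-terms-≡-closedForm : ∀ n k →
    sinSqPow 1 (2 ℕ.* suc n) * (+ 3) ^ k + sinSqPow 2 (2 ℕ.* suc n) * (+ 5) ^ k ≡ closedForm (suc n) k
  first-terms-≡-closedForm n k = begin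
    sinSqPow 1 (2 ℕ.* suc n) * (+ 3) ^ k + sinSqPow 2 (2 ℕ.* suc n) * (+ 5) ^ k
      ≡⟨ cong₂ (λ x y → x * (+ 3) ^ k + y * (+ 5) ^ k)
               (trans (sinSqPow-even 1 (suc n)) (cong (s *_) (evenPowerSum-1 n)))
               (trans (sinSqPow-even 2 (suc n)) (cong (s *_) (evenPowerSum-2 n))) ⟩
    s * - + 2 * (+ 3) ^ k + s * (+ 2 * (+ 4) ^ suc n - + 8) * (+ 5) ^ k
      ≡⟨ factor s ((+ 4) ^ suc n) ((+ 3) ^ k) ((+ 5) ^ k) ⟩
    closedForm (suc n) k ∎
    where
    s : ℤ
    s = -1ℤ ^ suc n
    factor : ∀ s f t₃ t₅ →
      s * - + 2 * t₃ + s * (+ 2 * f - + 8) * t₅ ≡ s * ((+ 2 * f - + 8) * t₅ - + 2 * t₃)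
    factor = solve-∀

  polyBern-≡-closedForm : ∀ n k →
    polyBernLevel2Neg (suc k) (2 ℕ.* suc n) ≡ closedForm (suc n) (suc k) mod + 7
  polyBern-≡-closedForm n k =
    subst (λ v → polyBernLevel2Neg (suc k) (2 ℕ.* suc n) ≡ v mod + 7) (first-terms-≡-closedForm n (suc k))
          (polyBern-≡-first-terms k (ℕ.m≤m*n 2 (suc n)))

  -- 4⁶ − 1 = 7 · 585, 5⁶ − 1 = 7 · 2232 and 3⁶ − 1 = 7 · 104.
  closedForm-periodicˡ : ∀ k n → closedForm (6 ℕ.+ n) k ≡ closedForm n k mod + 7
  closedForm-periodicˡ k n = ∣-difference (divides (s * + 1170 * f * t₅) (begin
    closedForm (6 ℕ.+ n) k - closedForm n k
      ≡⟨ cong₂ (λ s′ f′ → s′ * ((+ 2 * f′ - + 8) * t₅ - + 2 * t₃) - closedForm n k)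
               (ℤ.^-distribˡ-+-* -1ℤ 6 n) (ℤ.^-distribˡ-+-* (+ 4) 6 n) ⟩
    -1ℤ ^ 6 * s * ((+ 2 * ((+ 4) ^ 6 * f) - + 8) * t₅ - + 2 * t₃) - closedForm n k
      ≡⟨ multiple s f t₃ t₅ ⟩
    s * + 1170 * f * t₅ * + 7 ∎))
    where
    s f t₃ t₅ : ℤ
    s = -1ℤ ^ n
    f = (+ 4) ^ n
    t₃ = (+ 3) ^ k
    t₅ = (+ 5) ^ k
    multiple : ∀ s f t₃ t₅ →
      1ℤ * s * ((+ 2 * (+ 4096 * f) - + 8) * t₅ - + 2 * t₃) - s * ((+ 2 * f - + 8) * t₅ - + 2 * t₃)
      ≡ s * + 1170 * f * t₅ * + 7
    multiple = solve-∀

  closedForm-periodicʳ : ∀ n k → closedForm n (6 ℕ.+ k) ≡ closedForm n k mod + 7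
  closedForm-periodicʳ n k = ∣-difference (divides (s * ((+ 2 * f - + 8) * + 2232 * t₅ - + 208 * t₃)) (begin
    closedForm n (6 ℕ.+ k) - closedForm n k
      ≡⟨ cong₂ (λ t₃′ t₅′ → s * ((+ 2 * f - + 8) * t₅′ - + 2 * t₃′) - closedForm n k)
               (ℤ.^-distribˡ-+-* (+ 3) 6 k) (ℤ.^-distribˡ-+-* (+ 5) 6 k) ⟩
    s * ((+ 2 * f - + 8) * ((+ 5) ^ 6 * t₅) - + 2 * ((+ 3) ^ 6 * t₃)) - closedForm n k
      ≡⟨ multiple s f t₃ t₅ ⟩
    s * ((+ 2 * f - + 8) * + 2232 * t₅ - + 208 * t₃) * + 7 ∎))
    where
    s f t₃ t₅ : ℤ
    s = -1ℤ ^ n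
    f = (+ 4) ^ n
    t₃ = (+ 3) ^ k
    t₅ = (+ 5) ^ k
    multiple : ∀ s f t₃ t₅ →
      s * ((+ 2 * f - + 8) * (+ 15625 * t₅) - + 2 * (+ 729 * t₃)) - s * ((+ 2 * f - + 8) * t₅ - + 2 * t₃)
      ≡ s * ((+ 2 * f - + 8) * + 2232 * t₅ - + 208 * t₃) * + 7
    multiple = solve-∀

  polyBern-≡-closedForm-%6 : ∀ n k →
    polyBernLevel2Neg (suc k) (2 ℕ.* suc n) ≡ closedForm (suc n ℕ.% 6) (suc k ℕ.% 6) mod + 7
  polyBern-≡-closedForm-%6 n k =
    ≡-mod-trans (polyBern-≡-closedForm n k) (≡-mod-trans
      (≡-mod-periodic 6 (λ m → closedForm m (suc k)) (closedForm-periodicˡ (suc k)) (suc n))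
      (≡-mod-periodic 6 (closedForm (suc n ℕ.% 6)) (closedForm-periodicʳ (suc n ℕ.% 6)) (suc k)))

  closedForm-table : ∀ {a} → a < 6 → ∀ {b} → b < 6 → closedForm a b %ℕ 7 ≡ table a b
  closedForm-table =
    toWitness {a? = ℕ.allUpTo? (λ a → ℕ.allUpTo? (λ b → closedForm a b %ℕ 7 ℕ.≟ table a b) 6) 6} tt

open import Data.Nat using (ℕ; suc; _≤_; _*_; _%_; s≤s)
open import Data.Nat.DivMod using (m%n<n)
open import Data.Integer.DivMod using (_%ℕ_)
open import Relation.Binary.PropositionalEquality using (_≡_; module ≡-Reasoning)
open Congruences using (%ℕ-cong)
open PolyBernoulliModSeven using (closedForm; polyBern-≡-closedForm-%6; closedForm-table)

theorem13 : (n k : ℕ) → 1 ≤ n → 1 ≤ k →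
    polyBernLevel2Neg k (2 * n) %ℕ 7 ≡ table (n % 6) (k % 6)
theorem13 (suc n) (suc k) (s≤s _) (s≤s _) = begin
  polyBernLevel2Neg (suc k) (2 * suc n) %ℕ 7  ≡⟨ %ℕ-cong 7 (polyBern-≡-closedForm-%6 n k) ⟩
  closedForm (suc n % 6) (suc k % 6) %ℕ 7     ≡⟨ closedForm-table (m%n<n (suc n) 6) (m%n<n (suc k) 6) ⟩
  table (suc n % 6) (suc k % 6)               ∎
  where open ≡-Reasoning
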